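{- The only numerical semigroups that are both Arf and pseudo-symmetric are $\{0,3,4,5,6,\dots\}=\{0\}\cup\{i\in\mathbb{N}_0:i\geq 3\}$ and $\{0,3,5,6,7,\dots\}=\{0,3\}\cup\{i\in\mathbb{N}_0:i\geq 5\}$.
   Context: A numerical semigroup is a subset $\Lambda\subseteq\mathbb{N}_0$ containing $0$, closed under addition, with finite complement in $\mathbb{N}_0$. Its genus $g$ is $\#(\mathbb{N}_0\setminus\Lambda)$ and its conductor $c$ is the smallest integer with $c+\mathbb{N}_0\subseteq\Lambda$. $\Lambda$ is pseudo-symmetric if $c=2g-1$. With enumeration $\lambda:\mathbb{N}_0\to\Lambda$ (the increasing bijection, $\lambda_i=\lambda(i)$), $\Lambda$ is Arf if $\lambda_i+\lambda_j-\lambda_k\in\Lambda$ for all $i\geq j\geq k$ in $\mathbb{N}_0$. -}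

module Defs where

open import Data.Bool using (Bool; true; false; if_then_else_)
open import Data.Nat using (ℕ; zero; suc; _+_; _*_; _∸_; _≤_; _≤ᵇ_; _≡ᵇ_)
open import Data.Product using (Σ; _×_; _,_)
open import Data.Sum using (_⊎_)
open import Relation.Binary.PropositionalEquality using (_≡_)

Subset : Set
Subset = ℕ → Bool

_∈_ : ℕ → Subset → Set
n ∈ S = S n ≡ true

infix 4 _∈_

AllFrom : Subset → ℕ → Set
AllFrom S c = ∀ n → c ≤ n → n ∈ S

record IsNumericalSemigroup (S : Subset) : Set where
  field
    zero∈   : 0 ∈ S
    +-closed : ∀ x y → x ∈ S → y ∈ S → (x + y) ∈ S
    cofinite : Σ ℕ (λ N → AllFrom S N)

IsConductor : Subset → ℕ → Set
IsConductor S c = AllFrom S c × (∀ d → AllFrom S d → c ≤ d)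

gapsBelow : Subset → ℕ → ℕ
gapsBelow S zero    = 0
gapsBelow S (suc b) = (if S b then 0 else 1) + gapsBelow S b

-- genus (relative to the conductor c: all gaps lie below c) = #(ℕ₀ \ S)
genus : Subset → ℕ → ℕ
genus S c = gapsBelow S c

-- Pseudo-symmetric: c = 2g - 1 (as integers), i.e. c + 1 = 2g.
IsPseudoSymmetric : Subset → Set
IsPseudoSymmetric S = Σ ℕ (λ c → IsConductor S c × (c + 1 ≡ 2 * genus S c))

-- Arf: λ_i + λ_j - λ_k ∈ S for all i ≥ j ≥ k, where λ is the increasing
-- enumeration of S; written directly over elements x = λ_i ≥ y = λ_j ≥ z = λ_k.
IsArf : Subset → Set
IsArf S = ∀ x y z → x ∈ S → y ∈ S → z ∈ S → y ≤ x → z ≤ y → ((x + y) ∸ z) ∈ S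

S₁ : Subset
S₁ n = (n ≡ᵇ 0) Data.Bool.∨ (3 ≤ᵇ n)

S₂ : Subset
S₂ n = (n ≡ᵇ 0) Data.Bool.∨ (n ≡ᵇ 3) Data.Bool.∨ (5 ≤ᵇ n)

_≗ˢ_ : Subset → Subset → Set
S ≗ˢ T = ∀ n → S n ≡ T n

module Submission where

-- The key fact about Arf semigroups: if x and x+1 both lie in S, then so
-- does (x+1)+(x+1)−x = x+2, hence every n ≥ x lies in S and the conductor
-- c is at most x.  So below c no two consecutive integers lie in S, and
-- every pair {a, a+1} with a < c contains a gap.
--
-- Pseudo-symmetry c + 1 = 2g forces c = 2h+1 and g = h+1.  Then
--   * c−1 = 2h is a gap, so 2 ∉ S (otherwise every even number is in S),
--     and 1 ∉ S (otherwise 0, 1 are consecutive elements);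
--   * if h ≥ 3, counting gaps pairwise on [6, 2h) gives g ≥ #gaps<6 + h−2,
--     while among 3, 4, 5 at least two are gaps (3,5 ∈ S would give 5,6 ∈ S),
--     so #gaps<6 ≥ 4 and g ≥ h+2, a contradiction;
--   * h = 1 gives S₁, and h = 2 gives S₂ (g = 3 leaves 3 ∈ S).
-- Conversely S₁ and S₂ are checked to be Arf and pseudo-symmetric directly,
-- and both properties are invariant under pointwise equality of subsets.

open import Defs
open import Data.Bool using (Bool; true; false; if_then_else_)
open import Data.Bool.Properties using (¬-not)
open import Data.Empty using (⊥; ⊥-elim)
open import Data.Nat using (ℕ; zero; suc; _+_; _*_; _∸_; _≤_; _<_; z≤n; s≤s)
open import Data.Nat.Properties
open import Data.Nat.Tactic.RingSolver using (solve-∀)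
open import Data.Product using (Σ; _×_; _,_; proj₁; uncurry)
open import Data.Sum using (_⊎_; inj₁; inj₂)
open import Function using (case_of_)
open import Function.Bundles using (_⇔_; mk⇔)
open import Relation.Binary.PropositionalEquality
open import Relation.Nullary using (¬_; yes; no)

private
  variable
    S T : Subset
    a c n x : ℕ

gap : Bool → ℕ
gap b = if b then 0 else 1

gapsBelow-gap : ∀ S n → S n ≡ false → gapsBelow S (suc n) ≡ suc (gapsBelow S n)
gapsBelow-gap S n e = cong (λ b → gap b + gapsBelow S n) e

gap<bound : S n ≡ false → AllFrom S c → n < c
gap<bound {S} {n} {c} e full with c ≤? n
... | yes c≤n = case trans (sym e) (full n c≤n) of λ ()
... | no c≰n = ≰⇒> c≰n

conductor-pred-gap : IsConductor S (suc c) → S c ≡ false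
conductor-pred-gap {S} {c} (full , minimal) = ¬-not c∉S
  where
  c∉S : ¬ (c ∈ S)
  c∉S c∈S = 1+n≰n (minimal c fullFromC)
    where
    fullFromC : AllFrom S c
    fullFromC n c≤n with m≤n⇒m<n∨m≡n c≤n
    ... | inj₁ c<n = full n c<n
    ... | inj₂ refl = c∈S

multiple∈ : IsNumericalSemigroup S → x ∈ S → ∀ k → k * x ∈ S
multiple∈ ns x∈S zero = IsNumericalSemigroup.zero∈ ns
multiple∈ {x = x} ns x∈S (suc k) =
  IsNumericalSemigroup.+-closed ns x (k * x) x∈S (multiple∈ ns x∈S k)

arf-step : IsArf S → x ∈ S → suc x ∈ S → suc (suc x) ∈ S
arf-step {S} {x} arf x∈S sx∈S =
  subst (_∈ S) arith (arf (suc x) (suc x) x sx∈S sx∈S x∈S ≤-refl (n≤1+n x))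
  where
  arith : (suc x + suc x) ∸ x ≡ suc (suc x)
  arith = trans (cong (λ t → suc t ∸ x) (+-suc x x)) (m+n∸n≡m (suc (suc x)) x)

arf-consecutive⇒full : IsArf S → x ∈ S → suc x ∈ S → AllFrom S x
arf-consecutive⇒full {S} {x} arf x∈S sx∈S n x≤n =
  subst (_∈ S) (m∸n+n≡m x≤n) (proj₁ (pairFrom (n ∸ x)))
  where
  pairFrom : ∀ t → (t + x) ∈ S × (suc t + x) ∈ S
  pairFrom zero = x∈S , sx∈S
  pairFrom (suc t) with pairFrom t
  ... | p , q = q , arf-step arf p q

ConsecutiveOnlyFrom : Subset → ℕ → Set
ConsecutiveOnlyFrom S c = ∀ a → a ∈ S → suc a ∈ S → c ≤ a

arf-consecutiveOnlyFrom : IsArf S → IsConductor S c → ConsecutiveOnlyFrom S c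
arf-consecutiveOnlyFrom arf (_ , minimal) a a∈S sa∈S =
  minimal a (arf-consecutive⇒full arf a∈S sa∈S)

pair-has-gap : ConsecutiveOnlyFrom S c → a < c →
               suc (gapsBelow S a) ≤ gapsBelow S (suc (suc a))
pair-has-gap {S} {c} {a} cons a<c = count (S a) (S (suc a)) refl refl
  where
  G : ℕ
  G = gapsBelow S a
  count : ∀ b b′ → S a ≡ b → S (suc a) ≡ b′ → suc G ≤ gap b′ + (gap b + G)
  count true  true  ea eb = ⊥-elim (<-irrefl refl (<-≤-trans a<c (cons a ea eb)))
  count true  false ea eb = ≤-refl
  count false true  ea eb = ≤-refl
  count false false ea eb = n≤1+n (suc G)

pair-shift : ∀ j i → j + 2 * suc i ≡ 2 + (j + 2 * i)
pair-shift = solve-∀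

gapsBelow-pairs : ConsecutiveOnlyFrom S c → ∀ j i → j + 2 * i ≤ c →
                  gapsBelow S j + i ≤ gapsBelow S (j + 2 * i)
gapsBelow-pairs {S} cons j zero _ =
  ≤-reflexive (trans (+-identityʳ _) (cong (gapsBelow S) (sym (+-identityʳ j))))
gapsBelow-pairs {S} {c} cons j (suc i) bound = begin
  gapsBelow S j + suc i          ≡⟨ +-suc (gapsBelow S j) i ⟩
  suc (gapsBelow S j + i)        ≤⟨ s≤s (gapsBelow-pairs cons j i (<⇒≤ k<c)) ⟩
  suc (gapsBelow S k)            ≤⟨ pair-has-gap cons k<c ⟩
  gapsBelow S (2 + k)            ≡⟨ cong (gapsBelow S) (sym shift) ⟩
  gapsBelow S (j + 2 * suc i)    ∎
  where
  open ≤-Reasoning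
  k : ℕ
  k = j + 2 * i
  shift : j + 2 * suc i ≡ 2 + k
  shift = pair-shift j i
  k<c : k < c
  k<c = ≤-trans (n≤1+n (suc k)) (subst (_≤ c) shift bound)

double-suc : ∀ h → 2 * suc h ≡ suc (suc (2 * h))
double-suc = solve-∀

pseudoSymmetric-shape : ∀ c g → c + 1 ≡ 2 * g → Σ ℕ λ h → c ≡ suc (2 * h) × g ≡ suc h
pseudoSymmetric-shape c zero    eq = case trans (+-comm 1 c) eq of λ ()
pseudoSymmetric-shape c (suc h) eq =
  h , suc-injective (trans (+-comm 1 c) (trans eq (double-suc h))) , refl

-- If 0 < c, then 1 ∉ S: otherwise 0, 1 would be consecutive elements.
one∉ : IsNumericalSemigroup S → ConsecutiveOnlyFrom S (suc c) → S 1 ≡ false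
one∉ ns cons = ¬-not λ one∈ → case cons 0 (IsNumericalSemigroup.zero∈ ns) one∈ of λ ()

-- If c = 2h + 1, then 2 ∉ S: otherwise the gap 2h would be a multiple of 2.
two∉ : ∀ h → IsNumericalSemigroup S → IsConductor S (suc (2 * h)) → S 2 ≡ false
two∉ {S} h ns cond = ¬-not λ two∈ →
  case trans (sym (conductor-pred-gap cond))
             (subst (_∈ S) (*-comm h 2) (multiple∈ ns two∈ h)) of λ ()

-- If c ≥ 6 and 1, 2 are gaps, then there are at least four gaps below 6:
-- two of 3, 4, 5 are gaps, since 3, 5 ∈ S would make 5, 6 consecutive.
four-gaps-below-six : IsNumericalSemigroup S → ConsecutiveOnlyFrom S c → 6 ≤ c →
                      S 1 ≡ false → S 2 ≡ false → 4 ≤ gapsBelow S 6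
four-gaps-below-six {S} {c} ns cons 6≤c e1 e2 = count (S 3) (S 4) (S 5) refl refl refl
  where
  G : ℕ
  G = gapsBelow S 3
  two-gaps : 2 ≤ G
  two-gaps = subst (2 ≤_) (sym (trans (gapsBelow-gap S 2 e2) (cong suc (gapsBelow-gap S 1 e1))))
                   (s≤s (s≤s z≤n))
  below6 : ∀ a → a ∈ S → suc a ∈ S → a < 6 → ⊥
  below6 a a∈S sa∈S a<6 = <-irrefl refl (<-≤-trans a<6 (≤-trans 6≤c (cons a a∈S sa∈S)))
  count : ∀ b₃ b₄ b₅ → S 3 ≡ b₃ → S 4 ≡ b₄ → S 5 ≡ b₅ →
          4 ≤ gap b₅ + (gap b₄ + (gap b₃ + G))
  count true  true  _     e3 e4 e5 = ⊥-elim (below6 3 e3 e4 (s≤s (s≤s (s≤s (s≤s z≤n)))))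
  count _     true  true  e3 e4 e5 = ⊥-elim (below6 4 e4 e5 (s≤s (s≤s (s≤s (s≤s (s≤s z≤n))))))
  count true  false true  e3 e4 e5 =
    ⊥-elim (below6 5 e5 (IsNumericalSemigroup.+-closed ns 3 3 e3 e3) ≤-refl)
  count true  false false e3 e4 e5 = s≤s (s≤s two-gaps)
  count false true  false e3 e4 e5 = s≤s (s≤s two-gaps)
  count false false true  e3 e4 e5 = s≤s (s≤s two-gaps)
  count false false false e3 e4 e5 = s≤s (s≤s (m≤n⇒m≤1+n two-gaps))

three∈ : S 1 ≡ false → S 2 ≡ false → S 4 ≡ false → gapsBelow S 5 ≡ 3 → 3 ∈ S
three∈ {S} e1 e2 e4 genus≡ = ¬-not λ e3 → case trans (sym genus≡) (fourGaps e3) of λ ()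
  where
  fourGaps : S 3 ≡ false → gapsBelow S 5 ≡ 4 + gapsBelow S 1
  fourGaps e3 = begin
    gapsBelow S 5                ≡⟨ gapsBelow-gap S 4 e4 ⟩
    1 + gapsBelow S 4            ≡⟨ cong (1 +_) (gapsBelow-gap S 3 e3) ⟩
    2 + gapsBelow S 3            ≡⟨ cong (2 +_) (gapsBelow-gap S 2 e2) ⟩
    3 + gapsBelow S 2            ≡⟨ cong (3 +_) (gapsBelow-gap S 1 e1) ⟩
    4 + gapsBelow S 1            ∎
    where open ≡-Reasoning

double-shift : ∀ i → 2 * (3 + i) ≡ 6 + 2 * i
double-shift = solve-∀

-- For h = 3 + i, the four gaps below 6, the i pairs in [6, 2h) and the gap 2h
-- give genus ≥ i + 5 > h + 1.
no-large-half : ∀ {i} → IsNumericalSemigroup S → ConsecutiveOnlyFrom S (suc (2 * (3 + i))) →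
                S (2 * (3 + i)) ≡ false → S 1 ≡ false → S 2 ≡ false →
                gapsBelow S (suc (2 * (3 + i))) ≡ 4 + i → ⊥
no-large-half {S} {i} ns cons top e1 e2 genus≡ = <-irrefl refl (begin-strict
  4 + i                              ≤⟨ +-monoˡ-≤ i (four-gaps-below-six ns cons 6≤c e1 e2) ⟩
  gapsBelow S 6 + i                  ≤⟨ gapsBelow-pairs cons 6 i 6+2i≤c ⟩
  gapsBelow S (6 + 2 * i)            ≡⟨ cong (gapsBelow S) (sym (double-shift i)) ⟩
  gapsBelow S (2 * (3 + i))          <⟨ n<1+n _ ⟩
  suc (gapsBelow S (2 * (3 + i)))    ≡⟨ sym (gapsBelow-gap S (2 * (3 + i)) top) ⟩
  gapsBelow S (suc (2 * (3 + i)))    ≡⟨ genus≡ ⟩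
  4 + i                              ∎)
  where
  open ≤-Reasoning
  6+2i≤c : 6 + 2 * i ≤ suc (2 * (3 + i))
  6+2i≤c = subst (_≤ suc (2 * (3 + i))) (double-shift i) (n≤1+n _)
  6≤c : 6 ≤ suc (2 * (3 + i))
  6≤c = ≤-trans (m≤m+n 6 (2 * i)) 6+2i≤c

classify : IsNumericalSemigroup S → IsArf S → ∀ h → IsConductor S (suc (2 * h)) →
           genus S (suc (2 * h)) ≡ suc h → S ≗ˢ S₁ ⊎ S ≗ˢ S₂
classify ns arf zero cond _ =
  case trans (sym (IsNumericalSemigroup.zero∈ ns)) (conductor-pred-gap cond) of λ ()
classify ns arf 1 cond _ = inj₁ λ where
    0 → IsNumericalSemigroup.zero∈ ns
    1 → one∉ ns (arf-consecutiveOnlyFrom arf cond)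
    2 → two∉ 1 ns cond
    (suc (suc (suc k))) → proj₁ cond _ (s≤s (s≤s (s≤s z≤n)))
classify {S} ns arf 2 cond genus≡ = inj₂ λ where
    0 → IsNumericalSemigroup.zero∈ ns
    1 → e1
    2 → e2
    3 → three∈ {S} e1 e2 (conductor-pred-gap cond) genus≡
    4 → conductor-pred-gap cond
    (suc (suc (suc (suc (suc k))))) → proj₁ cond _ (s≤s (s≤s (s≤s (s≤s (s≤s z≤n)))))
  where
  e1 : S 1 ≡ false
  e1 = one∉ ns (arf-consecutiveOnlyFrom arf cond)
  e2 : S 2 ≡ false
  e2 = two∉ 2 ns cond
classify {S} ns arf (suc (suc (suc i))) cond genus≡ = ⊥-elim
  (no-large-half ns cons (conductor-pred-gap cond) (one∉ ns cons) (two∉ (3 + i) ns cond) genus≡)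
  where
  cons : ConsecutiveOnlyFrom S (suc (2 * (3 + i)))
  cons = arf-consecutiveOnlyFrom arf cond

arf-pseudoSymmetric⇒S₁⊎S₂ : IsNumericalSemigroup S → IsArf S → IsPseudoSymmetric S →
                            S ≗ˢ S₁ ⊎ S ≗ˢ S₂
arf-pseudoSymmetric⇒S₁⊎S₂ {S} ns arf (c , cond , eq)
  with pseudoSymmetric-shape c (genus S c) eq
... | h , refl , genus≡ = classify ns arf h cond genus≡

∈-resp : S ≗ˢ T → n ∈ S → n ∈ T
∈-resp {n = n} e n∈S = trans (sym (e n)) n∈S

≗ˢ-sym : S ≗ˢ T → T ≗ˢ S
≗ˢ-sym e n = sym (e n)

gapsBelow-resp : S ≗ˢ T → ∀ n → gapsBelow S n ≡ gapsBelow T n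
gapsBelow-resp e zero    = refl
gapsBelow-resp e (suc n) = cong₂ _+_ (cong gap (e n)) (gapsBelow-resp e n)

IsArf-resp : S ≗ˢ T → IsArf T → IsArf S
IsArf-resp e arf x y z x∈S y∈S z∈S y≤x z≤y =
  ∈-resp (≗ˢ-sym e) (arf x y z (∈-resp e x∈S) (∈-resp e y∈S) (∈-resp e z∈S) y≤x z≤y)

IsPseudoSymmetric-resp : S ≗ˢ T → IsPseudoSymmetric T → IsPseudoSymmetric S
IsPseudoSymmetric-resp e (c , (full , minimal) , eq) =
  c , ((λ n c≤n → ∈-resp (≗ˢ-sym e) (full n c≤n)) ,
       (λ d fullS → minimal d (λ n d≤n → ∈-resp e (fullS n d≤n)))) ,
  trans eq (cong (2 *_) (sym (gapsBelow-resp e c)))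

-- Arf triples whose largest element x lies beyond a bound from which T is
-- full are harmless, since x + y − z ≥ x.
arf-above : ∀ {x y z} → AllFrom T c → c ≤ x → z ≤ y → (x + y) ∸ z ∈ T
arf-above {x = x} full c≤x z≤y =
  full _ (≤-trans c≤x (subst (x ≤_) (sym (+-∸-assoc x z≤y)) (m≤m+n x _)))

S₁-full : AllFrom S₁ 3
S₁-full _ (s≤s (s≤s (s≤s _))) = refl

S₂-full : AllFrom S₂ 5
S₂-full _ (s≤s (s≤s (s≤s (s≤s (s≤s _))))) = refl

S₁-arf : IsArf S₁
S₁-arf 0 0 0 _ _ _ _ _ = refl
S₁-arf (suc (suc (suc k))) y z _ _ _ _ z≤y = arf-above S₁-full (s≤s (s≤s (s≤s z≤n))) z≤y

S₂-arf : IsArf S₂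
S₂-arf 0 0 0 _ _ _ _ _ = refl
S₂-arf 3 0 0 _ _ _ _ _ = refl
S₂-arf 3 3 0 _ _ _ _ _ = refl
S₂-arf 3 3 3 _ _ _ _ _ = refl
S₂-arf 3 3 (suc (suc (suc (suc z)))) _ _ _ _ (s≤s (s≤s (s≤s ())))
S₂-arf 3 (suc (suc (suc (suc y)))) _ _ _ _ (s≤s (s≤s (s≤s ()))) _
S₂-arf (suc (suc (suc (suc (suc k))))) y z _ _ _ _ z≤y =
  arf-above S₂-full (s≤s (s≤s (s≤s (s≤s (s≤s z≤n))))) z≤y

-- Conductor 3 (2 is a gap) and genus 2 (gaps 1, 2).
S₁-pseudoSymmetric : IsPseudoSymmetric S₁
S₁-pseudoSymmetric = 3 , (S₁-full , λ d full → gap<bound {S₁} {2} refl full) , refl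

-- Conductor 5 (4 is a gap) and genus 3 (gaps 1, 2, 4).
S₂-pseudoSymmetric : IsPseudoSymmetric S₂
S₂-pseudoSymmetric = 5 , (S₂-full , λ d full → gap<bound {S₂} {4} refl full) , refl

S₁⊎S₂⇒arf-pseudoSymmetric : S ≗ˢ S₁ ⊎ S ≗ˢ S₂ → IsArf S × IsPseudoSymmetric S
S₁⊎S₂⇒arf-pseudoSymmetric (inj₁ e) = IsArf-resp e S₁-arf , IsPseudoSymmetric-resp e S₁-pseudoSymmetric
S₁⊎S₂⇒arf-pseudoSymmetric (inj₂ e) = IsArf-resp e S₂-arf , IsPseudoSymmetric-resp e S₂-pseudoSymmetric

mainTheorem4 : (S : Subset) → IsNumericalSemigroup S →
    ((IsArf S × IsPseudoSymmetric S) ⇔ (S ≗ˢ S₁ ⊎ S ≗ˢ S₂))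
mainTheorem4 S ns =
  mk⇔ (uncurry (arf-pseudoSymmetric⇒S₁⊎S₂ ns)) S₁⊎S₂⇒arf-pseudoSymmetric
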